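{- A complete tableau is well-numbered: for every non-extremal block $B(i,j)$ one has $b(i,j)=i$ if $j$ is odd and $b(i,j)=i-1$ if $j$ is even.
   Context: Let $T=\{1,\dots,t\}$. A diagram of order $t+1$ is a tuple $(h_1,\dots,h_{t+1})$ of non-negative integers, pictured as columns $C_1,\dots,C_{t+1}$ of unit blocks; $B(i,j)$ ($1\le j\le h_i$) is the block of $C_i$ at level $j$ and $R_j$ the set of blocks at level $j$; the height of the diagram is $\max_ih_i$. Two distinct columns of height $\ge s$ are neighbours at level $s$ if every column strictly between them has height $<s$. A column is left (resp. right) extremal if it has no neighbour to its left (resp. right) at level equal to its height. Boundary conditions (always imposed): left extremal columns have even or maximal height; right extremal columns have odd or maximal height. A diagram is complete if no left even or right odd domino can be adjoined, where adjoining a domino means adding two blocks on top of a column of height $i$, the domino being even/odd as $i$ is and left (resp. right) if in the new diagram the enlarged column is the left (resp. right) neighbour at levels $i+1,i+2$ of some column of height $\ge i+2$. Tableau of a diagram: at each non-empty level $j$, the extremal block of $R_j$ is its rightmost block if $j$ is odd and its leftmost block if $j$ is even; extremal blocks receive no entry. Put $b(i,1)=i$ for every non-extremal $B(i,1)$; inductively for $j\ge1$, if $B(i,j+1)$ is non-extremal, $b(i,j+1)=b(k,j)$ where $C_k$ is the left neighbour (if $j$ is odd) resp. right neighbour (if $j$ is even) of $C_i$ at level $j$. A complete tableau is the tableau of a complete diagram. -}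

module Defs where

open import Data.Nat using (ℕ; zero; suc; _+_; _∸_; _≤_; _<_)
open import Data.Nat.Divisibility using (_∣_)
open import Data.Fin using (Fin; toℕ)
open import Data.Vec.Functional using (updateAt)
open import Data.Product using (Σ; _×_)
open import Data.Sum using (_⊎_)
open import Relation.Nullary using (¬_)

Even : ℕ → Set
Even n = 2 ∣ n

Odd : ℕ → Set
Odd n = ¬ (2 ∣ n)

-- A diagram of order t+1: heights of the columns C_1, …, C_{t+1}.
-- Column C_i is represented by the index  i-1 : Fin (suc t);
-- its number in the paper is  col i = toℕ i + 1.
Diagram : ℕ → Set
Diagram t = Fin (suc t) → ℕ

col : {t : ℕ} → Fin (suc t) → ℕ
col i = suc (toℕ i)

module _ {t : ℕ} (h : Diagram t) where

  LeftNbr : ℕ → Fin (suc t) → Fin (suc t) → Set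
  LeftNbr s k i =
    toℕ k < toℕ i × s ≤ h k × s ≤ h i ×
    (∀ m → toℕ k < toℕ m → toℕ m < toℕ i → h m < s)

  RightNbr : ℕ → Fin (suc t) → Fin (suc t) → Set
  RightNbr s k i =
    toℕ i < toℕ k × s ≤ h k × s ≤ h i ×
    (∀ m → toℕ i < toℕ m → toℕ m < toℕ k → h m < s)

  LeftExtremal : Fin (suc t) → Set
  LeftExtremal i = ¬ (Σ (Fin (suc t)) λ k → LeftNbr (h i) k i)

  RightExtremal : Fin (suc t) → Set
  RightExtremal i = ¬ (Σ (Fin (suc t)) λ k → RightNbr (h i) k i)

  MaximalHeight : Fin (suc t) → Set
  MaximalHeight i = ∀ k → h k ≤ h i

  BoundaryConditions : Set
  BoundaryConditions = ∀ i →
    (LeftExtremal i → Even (h i) ⊎ MaximalHeight i) ×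
    (RightExtremal i → Odd (h i) ⊎ MaximalHeight i)

  adjoin : Fin (suc t) → Diagram t
  adjoin c = updateAt h c (λ x → x + 2)

LeftEvenDomino : {t : ℕ} → Diagram t → Fin (suc t) → Set
LeftEvenDomino {t} h c =
  Even (h c) × BoundaryConditions (adjoin h c) ×
  Σ (Fin (suc t)) λ d →
    LeftNbr (adjoin h c) (h c + 1) c d × LeftNbr (adjoin h c) (h c + 2) c d

RightOddDomino : {t : ℕ} → Diagram t → Fin (suc t) → Set
RightOddDomino {t} h c =
  Odd (h c) × BoundaryConditions (adjoin h c) ×
  Σ (Fin (suc t)) λ d →
    RightNbr (adjoin h c) (h c + 1) c d × RightNbr (adjoin h c) (h c + 2) c d

Complete : {t : ℕ} → Diagram t → Set
Complete h = BoundaryConditions h × (∀ c → ¬ LeftEvenDomino h c × ¬ RightOddDomino h c)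

module _ {t : ℕ} (h : Diagram t) where

  ExtremalBlock : Fin (suc t) → ℕ → Set
  ExtremalBlock i j =
    (Odd j → ∀ k → j ≤ h k → toℕ k ≤ toℕ i) ×
    (Even j → ∀ k → j ≤ h k → toℕ i ≤ toℕ k)

  NonExtremal : Fin (suc t) → ℕ → Set
  NonExtremal i j = 1 ≤ j × j ≤ h i × ¬ ExtremalBlock i j

  -- Entry i j v :  b(i,j) = v  (v a column number in {1,…,t+1}),
  -- the inductive definition of the tableau
  data Entry : Fin (suc t) → ℕ → ℕ → Set where
    base : ∀ {i} → NonExtremal i 1 → Entry i 1 (col i)
    step-odd : ∀ {i j k v} → Odd j → NonExtremal i (suc j) →
      LeftNbr h j k i → Entry k j v → Entry i (suc j) v
    step-even : ∀ {i j k v} → Even j → NonExtremal i (suc j) →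
      RightNbr h j k i → Entry k j v → Entry i (suc j) v

module Submission where

-- At an even level j+1 a non-extremal block is not
-- leftmost, so C_i has a left neighbour C_k at the odd level j, and
-- b(i,j+1) = b(k,j) = k by induction; symmetrically at odd levels with right
-- neighbours.  What remains is that these neighbours are ADJACENT columns
-- (k = i-1, resp. k = i+1).  If they were not, the highest column strictly
-- between them would be below level j, and a domino could be adjoined on it:
-- a left even domino if its height is even, a right odd one if it is odd.
-- This contradicts completeness.

open import Defs
open import Data.Nat using (ℕ; zero; suc; _+_; _∸_; _⊓_; _≤_; _<_; z≤n; s≤s; z<s; _≤?_; _<?_)
open import Data.Nat.Properties
open import Data.Nat.Divisibility using (_∣_; _∣?_; divides; ∣⇒≤; ∣-refl; ∣m∣n⇒∣m+n; ∣m+n∣m⇒∣n)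
open import Data.Fin using (Fin; toℕ; fromℕ<)
open import Data.Fin.Properties using (toℕ<n; toℕ-fromℕ<; toℕ-injective; ¬∀⟶∃¬)
  renaming (_≟_ to _≟ᶠ_)
open import Data.Vec.Functional.Properties using (updateAt-updates; updateAt-minimal)
open import Data.Product using (Σ; _×_; _,_; proj₁; proj₂)
open import Data.Sum using (inj₁; inj₂)
import Data.Sum as Sum
open import Data.Empty using (⊥; ⊥-elim)
open import Relation.Nullary using (¬_; Dec; yes; no)
open import Relation.Nullary.Decidable using (_→-dec_)
open import Relation.Binary.PropositionalEquality using (_≡_; _≢_; refl; sym; trans; cong; subst; subst₂; ≢-sym)

odd-1 : Odd 1
odd-1 2∣1 with ∣⇒≤ 2∣1
... | s≤s ()

even+2 : ∀ {n} → Even n → Even (n + 2)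
even+2 e = ∣m∣n⇒∣m+n e ∣-refl

even-2 : ∀ {n} → Even (n + 2) → Even n
even-2 {n} e = ∣m+n∣m⇒∣n (subst (2 ∣_) (+-comm n 2) e) ∣-refl

odd+2 : ∀ {n} → Odd n → Odd (n + 2)
odd+2 o e = o (even-2 e)

even⇒odd-suc : ∀ {n} → Even n → Odd (suc n)
even⇒odd-suc {n} e e′ = odd-1 (∣m+n∣m⇒∣n (subst (2 ∣_) (+-comm 1 n) e′) e)

odd⇒even-suc : ∀ {n} → Odd n → Even (suc n)
odd⇒even-suc {zero} o = ⊥-elim (o (divides 0 refl))
odd⇒even-suc {suc n} o with 2 ∣? n
... | yes e = subst Even (+-comm n 2) (even+2 e)
... | no o′ = ⊥-elim (o (odd⇒even-suc o′))

+2≤ : ∀ {x y} → suc x < y → x + 2 ≤ y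
+2≤ {x} {y} = subst (_≤ y) (+-comm 2 x)

evenGap : ∀ {x y} → Even x → Even y → x < y → x + 2 ≤ y
evenGap ex ey x<y with m≤n⇒m<n∨m≡n x<y
... | inj₁ sx<y = +2≤ sx<y
... | inj₂ refl = ⊥-elim (even⇒odd-suc ex ey)

oddGap : ∀ {x y} → Odd x → Odd y → x < y → x + 2 ≤ y
oddGap ox oy x<y with m≤n⇒m<n∨m≡n x<y
... | inj₁ sx<y = +2≤ sx<y
... | inj₂ refl = ⊥-elim (oy (odd⇒even-suc ox))

IsRightmostMax : (ℕ → ℕ) → ℕ → ℕ → ℕ → Set
IsRightmostMax f lo hi p = lo ≤ p × p < hi ×
  (∀ x → lo ≤ x → x < hi → f x ≤ f p) × (∀ x → p < x → x < hi → f x < f p)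

IsLeftmostMax : (ℕ → ℕ) → ℕ → ℕ → ℕ → Set
IsLeftmostMax f lo hi p = lo ≤ p × p < hi ×
  (∀ x → lo ≤ x → x < hi → f x ≤ f p) × (∀ x → lo ≤ x → x < p → f x < f p)

singleton-max : (f : ℕ → ℕ) (lo : ℕ) → ∀ x → lo ≤ x → x < suc lo → f x ≤ f lo
singleton-max f lo x lo≤x x<1+lo = ≤-reflexive (cong f (≤-antisym (≤-pred x<1+lo) lo≤x))

rightmostMax : (f : ℕ → ℕ) {lo hi : ℕ} → lo < hi → Σ ℕ (IsRightmostMax f lo hi)
rightmostMax f {lo} {suc n} lo<hi with m<1+n⇒m<n∨m≡n lo<hi
... | inj₂ refl = lo , ≤-refl , n<1+n lo , singleton-max f lo ,
                  (λ x lo<x x<1+lo → ⊥-elim (<⇒≱ lo<x (≤-pred x<1+lo)))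
... | inj₁ lo<n with rightmostMax f lo<n
...   | p , lo≤p , p<n , max , strict with f p ≤? f n
...     | yes fp≤fn = n , <⇒≤ lo<n , n<1+n n , max′ ,
                      (λ x n<x x<1+n → ⊥-elim (<⇒≱ n<x (≤-pred x<1+n)))
  where
  max′ : ∀ x → lo ≤ x → x < suc n → f x ≤ f n
  max′ x lo≤x x<1+n with m<1+n⇒m<n∨m≡n x<1+n
  ... | inj₁ x<n = ≤-trans (max x lo≤x x<n) fp≤fn
  ... | inj₂ refl = ≤-refl
...     | no fp≰fn = p , lo≤p , m<n⇒m<1+n p<n , max′ , strict′
  where
  max′ : ∀ x → lo ≤ x → x < suc n → f x ≤ f p
  max′ x lo≤x x<1+n with m<1+n⇒m<n∨m≡n x<1+n
  ... | inj₁ x<n = max x lo≤x x<n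
  ... | inj₂ refl = <⇒≤ (≰⇒> fp≰fn)
  strict′ : ∀ x → p < x → x < suc n → f x < f p
  strict′ x p<x x<1+n with m<1+n⇒m<n∨m≡n x<1+n
  ... | inj₁ x<n = strict x p<x x<n
  ... | inj₂ refl = ≰⇒> fp≰fn

leftmostMax : (f : ℕ → ℕ) {lo hi : ℕ} → lo < hi → Σ ℕ (IsLeftmostMax f lo hi)
leftmostMax f {lo} {suc n} lo<hi with m<1+n⇒m<n∨m≡n lo<hi
... | inj₂ refl = lo , ≤-refl , n<1+n lo , singleton-max f lo ,
                  (λ x lo≤x x<lo → ⊥-elim (<⇒≱ x<lo lo≤x))
... | inj₁ lo<n with leftmostMax f lo<n
...   | p , lo≤p , p<n , max , strict with f p <? f n
...     | yes fp<fn = n , <⇒≤ lo<n , n<1+n n , max′ ,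
                      (λ x lo≤x x<n → ≤-<-trans (max x lo≤x x<n) fp<fn)
  where
  max′ : ∀ x → lo ≤ x → x < suc n → f x ≤ f n
  max′ x lo≤x x<1+n with m<1+n⇒m<n∨m≡n x<1+n
  ... | inj₁ x<n = ≤-trans (max x lo≤x x<n) (<⇒≤ fp<fn)
  ... | inj₂ refl = ≤-refl
...     | no fp≮fn = p , lo≤p , m<n⇒m<1+n p<n , max′ , strict
  where
  max′ : ∀ x → lo ≤ x → x < suc n → f x ≤ f p
  max′ x lo≤x x<1+n with m<1+n⇒m<n∨m≡n x<1+n
  ... | inj₁ x<n = max x lo≤x x<n
  ... | inj₂ refl = ≮⇒≥ fp≮fn

⊓-reach : ∀ {s a b} → s ≤ a → a ⊓ s ≤ b ⊓ s → s ≤ b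
⊓-reach {s} {a} {b} s≤a le = m≤n⊓o⇒m≤n b s (subst (_≤ b ⊓ s) (m≥n⇒m⊓n≡n s≤a) le)

⊓-below : ∀ {s a b} → a ⊓ s < b ⊓ s → a < s
⊓-below {s} {a} {b} lt =
  ≰⇒> λ s≤a → <⇒≱ lt (subst (b ⊓ s ≤_) (sym (m≥n⇒m⊓n≡n s≤a)) (m⊓n≤n b s))

module _ {t : ℕ} where

  clamp : ℕ → Fin (suc t)
  clamp n = fromℕ< (s≤s (m⊓n≤n n t))

  toℕ-clamp : ∀ {n} → n ≤ t → toℕ (clamp n) ≡ n
  toℕ-clamp n≤t = trans (toℕ-fromℕ< _) (m≤n⇒m⊓n≡m n≤t)

  clamp-toℕ : (x : Fin (suc t)) → clamp (toℕ x) ≡ x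
  clamp-toℕ x = toℕ-injective (toℕ-clamp (≤-pred (toℕ<n x)))

  rightmostMaxᶠ : (f : Fin (suc t) → ℕ) {lo hi : ℕ} → lo < hi → hi ≤ suc t →
    Σ (Fin (suc t)) λ c → lo ≤ toℕ c × toℕ c < hi ×
      (∀ x → lo ≤ toℕ x → toℕ x < hi → f x ≤ f c) ×
      (∀ x → toℕ c < toℕ x → toℕ x < hi → f x < f c)
  rightmostMaxᶠ f {lo} {hi} lo<hi hi≤ with rightmostMax (λ n → f (clamp n)) lo<hi
  ... | p , lo≤p , p<hi , max , strict =
    clamp p , subst (lo ≤_) (sym pos) lo≤p , subst (_< hi) (sym pos) p<hi ,
    (λ x lo≤x x<hi → subst (λ y → f y ≤ f (clamp p)) (clamp-toℕ x) (max (toℕ x) lo≤x x<hi)) ,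
    (λ x c<x x<hi → subst (λ y → f y < f (clamp p)) (clamp-toℕ x)
                      (strict (toℕ x) (subst (_< toℕ x) pos c<x) x<hi))
    where
    pos : toℕ (clamp p) ≡ p
    pos = toℕ-clamp (≤-pred (≤-trans p<hi hi≤))

  leftmostMaxᶠ : (f : Fin (suc t) → ℕ) {lo hi : ℕ} → lo < hi → hi ≤ suc t →
    Σ (Fin (suc t)) λ c → lo ≤ toℕ c × toℕ c < hi ×
      (∀ x → lo ≤ toℕ x → toℕ x < hi → f x ≤ f c) ×
      (∀ x → lo ≤ toℕ x → toℕ x < toℕ c → f x < f c)
  leftmostMaxᶠ f {lo} {hi} lo<hi hi≤ with leftmostMax (λ n → f (clamp n)) lo<hi
  ... | p , lo≤p , p<hi , max , strict =
    clamp p , subst (lo ≤_) (sym pos) lo≤p , subst (_< hi) (sym pos) p<hi ,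
    (λ x lo≤x x<hi → subst (λ y → f y ≤ f (clamp p)) (clamp-toℕ x) (max (toℕ x) lo≤x x<hi)) ,
    (λ x lo≤x x<c → subst (λ y → f y < f (clamp p)) (clamp-toℕ x)
                      (strict (toℕ x) lo≤x (subst (toℕ x <_) pos x<c)))
    where
    pos : toℕ (clamp p) ≡ p
    pos = toℕ-clamp (≤-pred (≤-trans p<hi hi≤))

  <⇒≢ᶠ : {x y : Fin (suc t)} → toℕ x < toℕ y → x ≢ y
  <⇒≢ᶠ x<y refl = <-irrefl refl x<y

  counterexample : {P Q : Fin (suc t) → Set} → (∀ x → Dec (P x)) → (∀ x → Dec (Q x)) →
    ¬ (∀ x → P x → Q x) → Σ (Fin (suc t)) λ x → P x × ¬ Q x
  counterexample {P} {Q} P? Q? ¬impl with ¬∀⟶∃¬ (suc t) _ (λ x → P? x →-dec Q? x) ¬impl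
  ... | x , ¬PQ with P? x | Q? x
  ...   | yes p | no ¬q = x , p , ¬q
  ...   | yes _ | yes q = ⊥-elim (¬PQ (λ _ → q))
  ...   | no ¬p | _     = ⊥-elim (¬PQ (λ p → ⊥-elim (¬p p)))

module _ {t : ℕ} (g : Diagram t) where

  -- If some column of height ≥ s lies left of C_i (itself of height ≥ s), then
  -- C_i has a left neighbour at level s: the nearest such column, found as the
  -- rightmost maximum of the heights capped at s.
  leftNbr-exists : ∀ {s} {k i} → toℕ k < toℕ i → s ≤ g k → s ≤ g i →
    Σ (Fin (suc t)) λ k′ → LeftNbr g s k′ i
  leftNbr-exists {s} {k} {i} k<i s≤gk s≤gi
    with rightmostMaxᶠ (λ x → g x ⊓ s) k<i (<⇒≤ (toℕ<n i))
  ... | c , _ , c<i , max , strict =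
    c , c<i , ⊓-reach s≤gk (max k ≤-refl k<i) , s≤gi ,
    (λ m c<m m<i → ⊓-below (strict m c<m m<i))

  rightNbr-exists : ∀ {s} {k i} → toℕ i < toℕ k → s ≤ g k → s ≤ g i →
    Σ (Fin (suc t)) λ k′ → RightNbr g s k′ i
  rightNbr-exists {s} {k} {i} i<k s≤gk s≤gi
    with leftmostMaxᶠ (λ x → g x ⊓ s) (s≤s i<k) (toℕ<n k)
  ... | c , i<c , _ , max , strict =
    c , i<c , ⊓-reach s≤gk (max k i<k (n<1+n _)) , s≤gi ,
    (λ m i<m m<c → ⊓-below (strict m i<m m<c))

  leftExtremal⇒lower : ∀ i → LeftExtremal g i → ∀ k → toℕ k < toℕ i → g k < g i
  leftExtremal⇒lower i extremal k k<i =
    ≰⇒> λ gi≤gk → extremal (leftNbr-exists k<i gi≤gk ≤-refl)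

  lower⇒leftExtremal : ∀ i → (∀ k → toℕ k < toℕ i → g k < g i) → LeftExtremal g i
  lower⇒leftExtremal i lower (k , k<i , gi≤gk , _) = <⇒≱ (lower k k<i) gi≤gk

  rightExtremal⇒lower : ∀ i → RightExtremal g i → ∀ k → toℕ i < toℕ k → g k < g i
  rightExtremal⇒lower i extremal k i<k =
    ≰⇒> λ gi≤gk → extremal (rightNbr-exists i<k gi≤gk ≤-refl)

  lower⇒rightExtremal : ∀ i → (∀ k → toℕ i < toℕ k → g k < g i) → RightExtremal g i
  lower⇒rightExtremal i lower (k , i<k , gi≤gk , _) = <⇒≱ (lower k i<k) gi≤gk

module _ {t : ℕ} {g g′ : Diagram t} (grows : ∀ k → g k ≤ g′ k) {i : Fin (suc t)} (same : g′ i ≡ g i) where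

  leftExtremal-shrink : LeftExtremal g′ i → LeftExtremal g i
  leftExtremal-shrink extremal = lower⇒leftExtremal g i λ k k<i →
    ≤-<-trans (grows k) (subst (g′ k <_) same (leftExtremal⇒lower g′ i extremal k k<i))

  rightExtremal-shrink : RightExtremal g′ i → RightExtremal g i
  rightExtremal-shrink extremal = lower⇒rightExtremal g i λ k i<k →
    ≤-<-trans (grows k) (subst (g′ k <_) same (rightExtremal⇒lower g′ i extremal k i<k))

module _ {t : ℕ} (h : Diagram t) (c : Fin (suc t)) where

  adjoin-at : adjoin h c c ≡ h c + 2
  adjoin-at = updateAt-updates c h

  adjoin-off : ∀ {k} → k ≢ c → adjoin h c k ≡ h k
  adjoin-off {k} = updateAt-minimal k c h

  adjoin-grows : ∀ k → h k ≤ adjoin h c k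
  adjoin-grows k with k ≟ᶠ c
  ... | yes refl = subst (h c ≤_) (sym adjoin-at) (m≤m+n (h c) 2)
  ... | no k≢c = ≤-reflexive (sym (adjoin-off k≢c))

  -- The boundary conditions survive adjoining a domino on C_c, provided some
  -- column C_e reaches the new height (so maximal columns stay maximal) and the
  -- enlarged column satisfies them.
  adjoin-BC : ∀ e → BoundaryConditions h → h c + 2 ≤ h e →
    (LeftExtremal (adjoin h c) c → Even (h c)) →
    (RightExtremal (adjoin h c) c → Odd (h c)) →
    BoundaryConditions (adjoin h c)
  adjoin-BC e bc tall leftC rightC i with i ≟ᶠ c
  ... | yes refl =
    (λ extremal → inj₁ (subst Even (sym adjoin-at) (even+2 (leftC extremal)))) ,
    (λ extremal → inj₁ (subst Odd (sym adjoin-at) (odd+2 (rightC extremal))))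
  ... | no i≢c =
    (λ extremal → Sum.map (subst Even (sym same)) stillMaximal
                    (proj₁ (bc i) (leftExtremal-shrink adjoin-grows same extremal))) ,
    (λ extremal → Sum.map (subst Odd (sym same)) stillMaximal
                    (proj₂ (bc i) (rightExtremal-shrink adjoin-grows same extremal)))
    where
    same : adjoin h c i ≡ h i
    same = adjoin-off i≢c
    stillMaximal : MaximalHeight h i → MaximalHeight (adjoin h c) i
    stillMaximal maximal k with k ≟ᶠ c
    ... | yes refl = subst₂ _≤_ (sym adjoin-at) (sym same) (≤-trans tall (maximal e))
    ... | no k≢c = subst₂ _≤_ (sym (adjoin-off k≢c)) (sym same) (maximal k)

  leftEvenDomino : ∀ {b} → BoundaryConditions h → toℕ c < toℕ b → Even (h c) → h c + 2 ≤ h b →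
    (∀ m → toℕ c < toℕ m → toℕ m < toℕ b → h m ≤ h c) → LeftEvenDomino h c
  leftEvenDomino {b} bc c<b even tall lower =
    even , adjoin-BC b bc tall (λ _ → even) notRightExtremal , b ,
    nbr (h c + 1) (m<m+n (h c) z<s) (+-monoʳ-≤ (h c) (s≤s z≤n)) ,
    nbr (h c + 2) (m<m+n (h c) z<s) ≤-refl
    where
    b-same : adjoin h c b ≡ h b
    b-same = adjoin-off (≢-sym (<⇒≢ᶠ c<b))
    notRightExtremal : RightExtremal (adjoin h c) c → Odd (h c)
    notRightExtremal extremal = ⊥-elim (<⇒≱ (rightExtremal⇒lower (adjoin h c) c extremal b c<b)
                                          (subst₂ _≤_ (sym adjoin-at) (sym b-same) tall))
    nbr : ∀ s → h c < s → s ≤ h c + 2 → LeftNbr (adjoin h c) s c b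
    nbr s hc<s s≤ = c<b , subst (s ≤_) (sym adjoin-at) s≤ , subst (s ≤_) (sym b-same) (≤-trans s≤ tall) ,
      λ m c<m m<b → subst (_< s) (sym (adjoin-off (≢-sym (<⇒≢ᶠ c<m)))) (≤-<-trans (lower m c<m m<b) hc<s)

  rightOddDomino : ∀ {a} → BoundaryConditions h → toℕ a < toℕ c → Odd (h c) → h c + 2 ≤ h a →
    (∀ m → toℕ a < toℕ m → toℕ m < toℕ c → h m ≤ h c) → RightOddDomino h c
  rightOddDomino {a} bc a<c odd tall lower =
    odd , adjoin-BC a bc tall notLeftExtremal (λ _ → odd) , a ,
    nbr (h c + 1) (m<m+n (h c) z<s) (+-monoʳ-≤ (h c) (s≤s z≤n)) ,
    nbr (h c + 2) (m<m+n (h c) z<s) ≤-refl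
    where
    a-same : adjoin h c a ≡ h a
    a-same = adjoin-off (<⇒≢ᶠ a<c)
    notLeftExtremal : LeftExtremal (adjoin h c) c → Even (h c)
    notLeftExtremal extremal = ⊥-elim (<⇒≱ (leftExtremal⇒lower (adjoin h c) c extremal a a<c)
                                         (subst₂ _≤_ (sym adjoin-at) (sym a-same) tall))
    nbr : ∀ s → h c < s → s ≤ h c + 2 → RightNbr (adjoin h c) s c a
    nbr s hc<s s≤ = a<c , subst (s ≤_) (sym adjoin-at) s≤ , subst (s ≤_) (sym a-same) (≤-trans s≤ tall) ,
      λ m a<m m<c → subst (_< s) (sym (adjoin-off (<⇒≢ᶠ m<c))) (≤-<-trans (lower m a<m m<c) hc<s)

module _ {t : ℕ} {h : Diagram t} (complete : Complete h) where

  -- Non-adjacent columns C_a, C_b cannot enclose only columns below level s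
  -- while C_b (resp. C_a) is two levels above every even (resp. odd) level
  -- below s: the highest enclosed column would host a domino.
  noGap : ∀ {a b s} → suc (toℕ a) < toℕ b →
    (∀ m → toℕ a < toℕ m → toℕ m < toℕ b → h m < s) →
    (∀ x → Even x → x < s → x + 2 ≤ h b) → (∀ x → Odd x → x < s → x + 2 ≤ h a) → ⊥
  noGap {a} {b} gap low evenTall oddTall with rightmostMaxᶠ h gap (<⇒≤ (toℕ<n b))
  ... | c , a<c , c<b , highest , _ with 2 ∣? h c
  ...   | yes even = proj₁ (proj₂ complete c)
          (leftEvenDomino h c (proj₁ complete) c<b even (evenTall (h c) even (low c a<c c<b))
            (λ m c<m m<b → highest m (<-trans a<c c<m) m<b))
  ...   | no odd = proj₂ (proj₂ complete c)
          (rightOddDomino h c (proj₁ complete) a<c odd (oddTall (h c) odd (low c a<c c<b))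
            (λ m a<m m<c → highest m a<m (<-trans m<c c<b)))

  leftNbr-adjacent : ∀ {j i k} → Odd j → suc j ≤ h i → LeftNbr h j k i → suc (toℕ k) ≡ toℕ i
  leftNbr-adjacent {i = i} {k = k} odd j<hi (k<i , j≤hk , _ , low) with suc (toℕ k) ≟ toℕ i
  ... | yes adjacent = adjacent
  ... | no ¬adjacent = ⊥-elim (noGap (≤∧≢⇒< k<i ¬adjacent) low
          (λ x _ x<j → ≤-trans (+2≤ (s≤s x<j)) j<hi)
          (λ x oddx x<j → ≤-trans (oddGap oddx odd x<j) j≤hk))

  rightNbr-adjacent : ∀ {j i k} → Even j → suc j ≤ h i → RightNbr h j k i → suc (toℕ i) ≡ toℕ k
  rightNbr-adjacent {i = i} {k = k} even j<hi (i<k , j≤hk , _ , low) with suc (toℕ i) ≟ toℕ k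
  ... | yes adjacent = adjacent
  ... | no ¬adjacent = ⊥-elim (noGap (≤∧≢⇒< i<k ¬adjacent) low
          (λ x evenx x<j → ≤-trans (evenGap evenx even x<j) j≤hk)
          (λ x _ x<j → ≤-trans (+2≤ (s≤s x<j)) j<hi))

module _ {t : ℕ} {h : Diagram t} where

  notLeftmost : ∀ {i j} → Even j → ¬ ExtremalBlock h i j →
    Σ (Fin (suc t)) λ k → j ≤ h k × toℕ k < toℕ i
  notLeftmost {i} {j} even nonExtremal
    with counterexample (λ k → j ≤? h k) (λ k → toℕ i ≤? toℕ k)
           (λ leftmost → nonExtremal ((λ odd → ⊥-elim (odd even)) , (λ _ → leftmost)))
  ... | k , j≤hk , i≰k = k , j≤hk , ≰⇒> i≰k

  notRightmost : ∀ {i j} → Odd j → ¬ ExtremalBlock h i j →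
    Σ (Fin (suc t)) λ k → j ≤ h k × toℕ i < toℕ k
  notRightmost {i} {j} odd nonExtremal
    with counterexample (λ k → j ≤? h k) (λ k → toℕ k ≤? toℕ i)
           (λ rightmost → nonExtremal ((λ _ → rightmost) , (λ even → ⊥-elim (odd even))))
  ... | k , j≤hk , k≰i = k , j≤hk , ≰⇒> k≰i

  leftNbr-nonExtremal : ∀ {i j k} → 1 ≤ j → Odd j → LeftNbr h j k i → NonExtremal h k j
  leftNbr-nonExtremal {i} 1≤j odd (k<i , j≤hk , j≤hi , _) =
    1≤j , j≤hk , λ extremal → <⇒≱ k<i (proj₁ extremal odd i j≤hi)

  rightNbr-nonExtremal : ∀ {i j k} → 1 ≤ j → Even j → RightNbr h j k i → NonExtremal h k j
  rightNbr-nonExtremal {i} 1≤j even (i<k , j≤hk , j≤hi , _) =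
    1≤j , j≤hk , λ extremal → <⇒≱ i<k (proj₂ extremal even i j≤hi)

module _ {t : ℕ} {h : Diagram t} (complete : Complete h) where

  -- Even level j+1: b(i,j+1) = b(i-1,j) = i-1.
  evenLevel : ∀ {i j} → 1 ≤ j → Odd j → Even (suc j) → NonExtremal h i (suc j) →
    (∀ k → NonExtremal h k j → Entry h k j (col k)) → Entry h i (suc j) (col i ∸ 1)
  evenLevel {i} {j} 1≤j odd even nonExt@(_ , j<hi , notExtremal) below
    with notLeftmost even notExtremal
  ... | k , j<hk , k<i with leftNbr-exists h k<i (≤-trans (n≤1+n j) j<hk) (≤-trans (n≤1+n j) j<hi)
  ...   | k₀ , nbr = subst (Entry h i (suc j)) (leftNbr-adjacent complete odd j<hi nbr)
                       (step-odd odd nonExt nbr (below k₀ (leftNbr-nonExtremal 1≤j odd nbr)))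

  -- Odd level j+1: b(i,j+1) = b(i+1,j) = (i+1)-1 = i.
  oddLevel : ∀ {i j} → 1 ≤ j → Even j → Odd (suc j) → NonExtremal h i (suc j) →
    (∀ k → NonExtremal h k j → Entry h k j (col k ∸ 1)) → Entry h i (suc j) (col i)
  oddLevel {i} {j} 1≤j even odd nonExt@(_ , j<hi , notExtremal) below
    with notRightmost odd notExtremal
  ... | k , j<hk , i<k with rightNbr-exists h i<k (≤-trans (n≤1+n j) j<hk) (≤-trans (n≤1+n j) j<hi)
  ...   | k₀ , nbr = subst (Entry h i (suc j)) (sym (rightNbr-adjacent complete even j<hi nbr))
                       (step-even even nonExt nbr (below k₀ (rightNbr-nonExtremal 1≤j even nbr)))

  WellNumbered : ℕ → Set
  WellNumbered j = ∀ i → NonExtremal h i j →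
    (Odd j → Entry h i j (col i)) × (Even j → Entry h i j (col i ∸ 1))

  wellNumbered-step : ∀ j → WellNumbered (suc j) → WellNumbered (suc (suc j))
  wellNumbered-step j below i nonExt with 2 ∣? suc j
  ... | yes even =
    (λ _ → oddLevel (s≤s z≤n) even (even⇒odd-suc even) nonExt (λ k nk → proj₂ (below k nk) even)) ,
    (λ even′ → ⊥-elim (even⇒odd-suc even even′))
  ... | no odd =
    (λ odd′ → ⊥-elim (odd′ (odd⇒even-suc odd))) ,
    (λ even → evenLevel (s≤s z≤n) odd even nonExt (λ k nk → proj₁ (below k nk) odd))

  wellNumbered : ∀ j → WellNumbered j
  wellNumbered zero i (() , _)
  wellNumbered (suc zero) i nonExt = (λ _ → base nonExt) , (λ even → ⊥-elim (odd-1 even))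
  wellNumbered (suc (suc j)) = wellNumbered-step j (wellNumbered (suc j))

lemma3p1 : (t : ℕ) (h : Diagram t) → Complete h →
    ∀ i j → NonExtremal h i j →
      (Odd j → Entry h i j (col i)) × (Even j → Entry h i j (col i ∸ 1))
lemma3p1 t h complete i j = wellNumbered complete j i
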